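{- Let $n \ge 5$ and let $K$ be a $2$-dimensional shifted simplicial complex with $K\subseteq\Delta(5,n)$. Then \[ f_2(K) \leq 4f_1(K)-8 < 4 f_1(K). \]
   Context: A simplicial complex $K$ with vertex set contained in $[n]=\{1,\dots,n\}$ is shifted if for every $F \in K$, $i \in F$ and $j < i$ we have $(F\setminus\{i\}) \cup \{j\} \in K$. For integers $a,b$ write $[a,b]=\{a,a+1,\dots,b\}$ (empty if $a>b$). $\Delta(d,n)$ denotes the pure $(d-1)$-dimensional simplicial complex on vertex set $[n]$ whose maximal simplices are the $d$-element sets $S\subseteq[n]$ such that for all $k\in[n]$: $k \notin S \Rightarrow [k+1,d-k+2] \subseteq S$ (together with all their subsets). $f_i(K)$ is the number of $i$-dimensional simplices of $K$, and $K\subseteq \Delta(5,n)$ means every simplex of $K$ is a simplex of $\Delta(5,n)$. -}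

module Defs where

open import Data.Nat using (ℕ; zero; suc; _+_; _≤_; _<_; _≡ᵇ_)
open import Data.Bool using (Bool; true; false; _∧_)
open import Data.Fin using (Fin; toℕ) renaming (_<_ to _<ᶠ_)
open import Data.Fin.Subset using (Subset; inside; outside; _∈_; _∉_; _⊆_; ∣_∣)
open import Data.Vec using (Vec; []; _∷_; _[_]≔_)
open import Data.List using (List; [_]; _++_; map; length; filterᵇ)
open import Data.Product using (Σ; _×_)
open import Relation.Binary.PropositionalEquality using (_≡_)

-- A (finite) family of candidate faces on vertex set [n] = Fin n
-- (Fin element i stands for vertex i+1).  A complex is given by its
-- decidable membership predicate.
Family : ℕ → Set
Family n = Subset n → Bool

_∈K_ : ∀ {n} → Subset n → Family n → Set
S ∈K K = K S ≡ true

IsSimplicialComplex : ∀ {n} → Family n → Set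
IsSimplicialComplex {n} K = ∀ (S T : Subset n) → T ⊆ S → S ∈K K → T ∈K K

IsTwoDimensional : ∀ {n} → Family n → Set
IsTwoDimensional {n} K =
  Σ (Subset n) (λ S → S ∈K K × ∣ S ∣ ≡ 3) × (∀ (S : Subset n) → S ∈K K → ∣ S ∣ ≤ 3)

IsShifted : ∀ {n} → Family n → Set
IsShifted {n} K = ∀ (F : Subset n) (i j : Fin n) → F ∈K K → i ∈ F → j <ᶠ i →
  ((F [ i ]≔ outside) [ j ]≔ inside) ∈K K

_∈ℕ_ : ∀ {n} → ℕ → Subset n → Set
_∈ℕ_ {n} m S = Σ (Fin n) (λ i → suc (toℕ i) ≡ m × i ∈ S)

-- facets of Δ(d,n): d-sets S with  k ∉ S ⇒ [k+1, d-k+2] ⊆ S  for all k ∈ [n]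
IsDeltaFacet : (d n : ℕ) → Subset n → Set
IsDeltaFacet d n S = ∣ S ∣ ≡ d ×
  (∀ (k : Fin n) → k ∉ S → ∀ (m : ℕ) → suc (suc (toℕ k)) ≤ m → m + suc (toℕ k) ≤ d + 2 → m ∈ℕ S)

InDelta : (d n : ℕ) → Subset n → Set
InDelta d n T = Σ (Subset n) (λ S → IsDeltaFacet d n S × T ⊆ S)

SubcomplexOfDelta : (d n : ℕ) → Family n → Set
SubcomplexOfDelta d n K = ∀ (T : Subset n) → T ∈K K → InDelta d n T

allSubsets : (n : ℕ) → List (Subset n)
allSubsets zero = [ [] ]
allSubsets (suc n) = map (outside ∷_) (allSubsets n) ++ map (inside ∷_) (allSubsets n)

f : ∀ {n} → ℕ → Family n → ℕ
f {n} i K = length (filterᵇ (λ S → K S ∧ (∣ S ∣ ≡ᵇ suc i)) (allSubsets n))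

module Submission where

-- Write D = K ∖ {1} for the deletion and L = lk 1 for the link of vertex 1, so
-- that f₁(K) = f₁(D) + f₀(L) and f₂(K) = f₂(D) + f₁(L).  Removing the smallest
-- vertex maps the triangles whose smallest vertex is v ∈ {1,2,3,4} injectively
-- into the edges of D, and no triangle avoids {1,2,3,4}, because every facet of
-- Δ(5,n) contains at least three of these four vertices.  Hence f₂(K) ≤ 4 f₁(D).
-- Shiftedness moves a triangle onto vertex 1, so L has at least two vertices and
-- f₁(K) ≥ f₁(D) + 2.

open import Defs
open import Data.Bool using (Bool; true; false; _∧_; T; if_then_else_)
open import Data.Empty using (⊥-elim)
open import Data.Fin using (Fin; zero; suc; toℕ; #_)
open import Data.Fin.Properties using (toℕ-injective)
open import Data.Fin.Subset using (Subset; inside; outside; ⊥; _∈_; _∉_; ∣_∣; Nonempty)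
open import Data.Fin.Subset.Properties
  using (s⊆s; out⊆; ⊆-refl; ⊆-min; drop-∷-⊆; ∣⊥∣≡0; ∣p∣≤∣x∷p∣; p⊆q⇒∣p∣≤∣q∣)
open import Data.List using (List; []; _∷_; _++_; map; length; filterᵇ)
open import Data.List.Properties using (length-++; filter-++)
open import Data.Nat using (ℕ; zero; suc; _+_; _*_; _≤_; _<_; _≡ᵇ_; z≤n; s≤s; z<s; s<s)
open import Data.Nat.Properties
open import Data.Product using (Σ; _×_; _,_; proj₁)
open import Data.Unit using (tt)
open import Data.Vec using ([]; _∷_; _[_]≔_; here; there)
open import Relation.Binary.PropositionalEquality

count : ∀ {n} → (Subset n → Bool) → ℕ
count {zero}  p = if p [] then 1 else 0
count {suc n} p = count (λ S → p (outside ∷ S)) + count (λ S → p (inside ∷ S))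

length-filterᵇ-map : ∀ {A B : Set} (p : B → Bool) (g : A → B) (xs : List A) →
  length (filterᵇ p (map g xs)) ≡ length (filterᵇ (λ x → p (g x)) xs)
length-filterᵇ-map p g [] = refl
length-filterᵇ-map p g (x ∷ xs) with p (g x)
... | true  = cong suc (length-filterᵇ-map p g xs)
... | false = length-filterᵇ-map p g xs

length-filterᵇ-allSubsets : ∀ n (p : Subset n → Bool) →
  length (filterᵇ p (allSubsets n)) ≡ count p
length-filterᵇ-allSubsets zero p with p []
... | true  = refl
... | false = refl
length-filterᵇ-allSubsets (suc n) p = begin
  length (filterᵇ p (map (outside ∷_) Ss ++ map (inside ∷_) Ss))
    ≡⟨ cong length (filter-++ _ (map (outside ∷_) Ss) (map (inside ∷_) Ss)) ⟩
  length (filterᵇ p (map (outside ∷_) Ss) ++ filterᵇ p (map (inside ∷_) Ss))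
    ≡⟨ length-++ (filterᵇ p (map (outside ∷_) Ss)) ⟩
  length (filterᵇ p (map (outside ∷_) Ss)) + length (filterᵇ p (map (inside ∷_) Ss))
    ≡⟨ cong₂ _+_ (trans (length-filterᵇ-map p _ Ss) (length-filterᵇ-allSubsets n _))
                 (trans (length-filterᵇ-map p _ Ss) (length-filterᵇ-allSubsets n _)) ⟩
  count p ∎
  where
  open ≡-Reasoning
  Ss = allSubsets n

count-mono : ∀ {n} {p q : Subset n → Bool} → (∀ S → p S ≡ true → q S ≡ true) → count p ≤ count q
count-mono {zero} {p} {q} p⇒q with p [] in eq
... | false = z≤n
... | true rewrite p⇒q [] eq = ≤-refl
count-mono {suc n} p⇒q =
  +-mono-≤ (count-mono (λ S → p⇒q (outside ∷ S))) (count-mono (λ S → p⇒q (inside ∷ S)))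

count-pos : ∀ {n} {p : Subset n → Bool} (S : Subset n) → p S ≡ true → 1 ≤ count p
count-pos {zero} [] pS rewrite pS = ≤-refl
count-pos {suc n} {p} (outside ∷ S) pS =
  ≤-trans (count-pos S pS) (m≤m+n _ (count (λ S → p (inside ∷ S))))
count-pos {suc n} {p} (inside ∷ S) pS =
  ≤-trans (count-pos S pS) (m≤n+m _ (count (λ S → p (outside ∷ S))))

count-none : ∀ {n} {p : Subset n → Bool} → (∀ S → p S ≢ true) → count p ≡ 0
count-none {zero} {p} ¬p with p [] in eq
... | false = refl
... | true = ⊥-elim (¬p [] eq)
count-none {suc n} ¬p =
  cong₂ _+_ (count-none (λ S → ¬p (outside ∷ S))) (count-none (λ S → ¬p (inside ∷ S)))

f≡count : ∀ {n} i (K : Family n) → f i K ≡ count (λ S → K S ∧ (∣ S ∣ ≡ᵇ suc i))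
f≡count {n} i K = length-filterᵇ-allSubsets n _

deletion link : ∀ {n} → Family (suc n) → Family n
deletion K S = K (outside ∷ S)
link K S = K (inside ∷ S)

deletionⁿ : ∀ {n} j → Family (j + n) → Family n
deletionⁿ zero K = K
deletionⁿ (suc j) K = deletionⁿ j (deletion K)

f-deletion-link : ∀ {n} i (K : Family (suc n)) →
  f (suc i) K ≡ f (suc i) (deletion K) + f i (link K)
f-deletion-link i K = begin
  f (suc i) K
    ≡⟨ f≡count (suc i) K ⟩
  count (λ S → deletion K S ∧ (∣ S ∣ ≡ᵇ suc (suc i))) + count (λ S → link K S ∧ (∣ S ∣ ≡ᵇ suc i))
    ≡⟨ sym (cong₂ _+_ (f≡count (suc i) (deletion K)) (f≡count i (link K))) ⟩
  f (suc i) (deletion K) + f i (link K) ∎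
  where open ≡-Reasoning

f-deletion≤ : ∀ {n} i (K : Family (suc n)) → f i (deletion K) ≤ f i K
f-deletion≤ i K rewrite f≡count i K | f≡count i (deletion K) = m≤m+n _ _

f-mono : ∀ {n} i {K L : Family n} → (∀ S → S ∈K K → S ∈K L) → f i K ≤ f i L
f-mono i {K} {L} K⊆L rewrite f≡count i K | f≡count i L = count-mono face⇒face
  where
  face⇒face : ∀ S → K S ∧ (∣ S ∣ ≡ᵇ suc i) ≡ true → L S ∧ (∣ S ∣ ≡ᵇ suc i) ≡ true
  face⇒face S e with K S in kS
  ... | true rewrite K⊆L S kS = e

f-above-dim≡0 : ∀ {n} i (K : Family n) → (∀ S → S ∈K K → ∣ S ∣ ≤ i) → f i K ≡ 0
f-above-dim≡0 i K dim≤i rewrite f≡count i K = count-none no-face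
  where
  no-face : ∀ S → K S ∧ (∣ S ∣ ≡ᵇ suc i) ≢ true
  no-face S e with K S in kS
  ... | true = <⇒≱ (≤-reflexive (sym (≡ᵇ⇒≡ ∣ S ∣ (suc i) (subst T (sym e) tt)))) (dim≤i S kS)

IsSimplicialComplex-deletion : ∀ {n} {K : Family (suc n)} →
  IsSimplicialComplex K → IsSimplicialComplex (deletion K)
IsSimplicialComplex-deletion closed S T T⊆S = closed (outside ∷ S) (outside ∷ T) (s⊆s T⊆S)

IsSimplicialComplex-link : ∀ {n} {K : Family (suc n)} →
  IsSimplicialComplex K → IsSimplicialComplex (link K)
IsSimplicialComplex-link closed S T T⊆S = closed (inside ∷ S) (inside ∷ T) (s⊆s T⊆S)

link⊆deletion : ∀ {n} {K : Family (suc n)} → IsSimplicialComplex K →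
  ∀ S → S ∈K link K → S ∈K deletion K
link⊆deletion closed S = closed (inside ∷ S) (outside ∷ S) (out⊆ ⊆-refl)

∣face∣≤f₀ : ∀ {n} {K : Family n} → IsSimplicialComplex K → ∀ S → S ∈K K → ∣ S ∣ ≤ f 0 K
∣face∣≤f₀ {zero} _ [] _ = z≤n
∣face∣≤f₀ {suc n} {K} closed (s ∷ S) sS∈K = subst (∣ s ∷ S ∣ ≤_) (sym f₀-split) (bound s sS∈K)
  where
  empty-link-face : Subset n → Bool
  empty-link-face S = link K S ∧ (∣ S ∣ ≡ᵇ 0)

  first-vertex : ℕ
  first-vertex = count empty-link-face

  f₀-split : f 0 K ≡ f 0 (deletion K) + first-vertex
  f₀-split = trans (f≡count 0 K) (cong (_+ first-vertex) (sym (f≡count 0 (deletion K))))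

  ih : ∣ S ∣ ≤ f 0 (deletion K)
  ih = ∣face∣≤f₀ (IsSimplicialComplex-deletion closed) S
         (closed (s ∷ S) (outside ∷ S) (out⊆ ⊆-refl) sS∈K)

  bound : ∀ s → (s ∷ S) ∈K K → ∣ s ∷ S ∣ ≤ f 0 (deletion K) + first-vertex
  bound outside _ = ≤-trans ih (m≤m+n _ _)
  bound inside iS∈K =
    subst (_≤ f 0 (deletion K) + first-vertex) (+-comm ∣ S ∣ 1)
      (+-mono-≤ ih (count-pos {p = empty-link-face} ⊥ vertex))
    where
    vertex : empty-link-face ⊥ ≡ true
    vertex rewrite closed (inside ∷ S) (inside ∷ ⊥) (s⊆s (⊆-min S)) iS∈K | ∣⊥∣≡0 n = refl

f-suc≤deletion : ∀ {n} i {K : Family (suc n)} → IsSimplicialComplex K →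
  f (suc i) K ≤ f (suc i) (deletion K) + f i (deletion K)
f-suc≤deletion i {K} closed = begin
  f (suc i) K                               ≡⟨ f-deletion-link i K ⟩
  f (suc i) (deletion K) + f i (link K)     ≤⟨ +-monoʳ-≤ _ (f-mono i (link⊆deletion closed)) ⟩
  f (suc i) (deletion K) + f i (deletion K) ∎
  where open ≤-Reasoning

f-suc≤deletionⁿ : ∀ {n} i j {K : Family (suc j + n)} → IsSimplicialComplex K →
  f (suc i) K ≤ f (suc i) (deletionⁿ (suc j) K) + suc j * f i (deletion K)
f-suc≤deletionⁿ i zero {K} closed rewrite *-identityˡ (f i (deletion K)) =
  f-suc≤deletion i closed
f-suc≤deletionⁿ i (suc j) {K} closed = begin
  f (suc i) K
    ≤⟨ f-suc≤deletion i closed ⟩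
  f (suc i) D + a
    ≤⟨ +-monoˡ-≤ a (f-suc≤deletionⁿ i j (IsSimplicialComplex-deletion closed)) ⟩
  x + suc j * f i (deletion D) + a
    ≤⟨ +-monoˡ-≤ a (+-monoʳ-≤ x (*-monoʳ-≤ (suc j) (f-deletion≤ i D))) ⟩
  x + suc j * a + a
    ≡⟨ +-assoc x (suc j * a) a ⟩
  x + (suc j * a + a)
    ≡⟨ cong (x +_) (+-comm (suc j * a) a) ⟩
  x + suc (suc j) * a ∎
  where
  open ≤-Reasoning
  D = deletion K
  a = f i D
  x = f (suc i) (deletionⁿ (suc (suc j)) K)

deltaFacet-∈ : ∀ {d n} {F : Subset n} → IsDeltaFacet d n F → (k j : Fin n) →
  k ∉ F → toℕ k < toℕ j → toℕ j + toℕ k ≤ d → j ∈ F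
deltaFacet-∈ {d} {F = F} (_ , missing⇒∈) k j k∉F k<j j+k≤d
  with missing⇒∈ k k∉F (suc (toℕ j)) (s≤s k<j) bounded
  where
  bounded : suc (toℕ j) + suc (toℕ k) ≤ d + 2
  bounded = subst₂ _≤_ (cong suc (sym (+-suc (toℕ j) (toℕ k)))) (+-comm 2 d) (s≤s (s≤s j+k≤d))
... | i , i≡j , i∈F = subst (_∈ F) (toℕ-injective (suc-injective i≡j)) i∈F

three-of-first-four : ∀ {m} {f₁ f₂ f₃ f₄ : Bool} {F : Subset m} →
  IsDeltaFacet 5 (4 + m) (f₁ ∷ f₂ ∷ f₃ ∷ f₄ ∷ F) → 3 + ∣ F ∣ ≤ ∣ f₁ ∷ f₂ ∷ f₃ ∷ f₄ ∷ F ∣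
three-of-first-four {f₁ = outside} facet
  with deltaFacet-∈ facet (# 0) (# 1) (λ ()) z<s (m≤m+n 1 4)
     | deltaFacet-∈ facet (# 0) (# 2) (λ ()) z<s (m≤m+n 2 3)
     | deltaFacet-∈ facet (# 0) (# 3) (λ ()) z<s (m≤m+n 3 2)
... | there here | there (there here) | there (there (there here)) = ≤-refl
three-of-first-four {f₁ = inside} {f₂ = outside} facet
  with deltaFacet-∈ facet (# 1) (# 2) (λ { (there ()) }) (s<s z<s) (m≤m+n 3 2)
     | deltaFacet-∈ facet (# 1) (# 3) (λ { (there ()) }) (s<s z<s) (m≤m+n 4 1)
... | there (there here) | there (there (there here)) = ≤-refl
three-of-first-four {f₁ = inside} {f₂ = inside} {f₃ = outside} facet
  with deltaFacet-∈ facet (# 2) (# 3) (λ { (there (there ())) }) (s<s (s<s z<s)) ≤-refl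
... | there (there (there here)) = ≤-refl
three-of-first-four {f₁ = inside} {f₂ = inside} {f₃ = inside} {f₄} {F} _ =
  +-monoʳ-≤ 3 (∣p∣≤∣x∷p∣ f₄ F)

deltaFacet-beyond-4-≤2 : ∀ {m} {f₁ f₂ f₃ f₄ : Bool} {F : Subset m} →
  IsDeltaFacet 5 (4 + m) (f₁ ∷ f₂ ∷ f₃ ∷ f₄ ∷ F) → ∣ F ∣ ≤ 2
deltaFacet-beyond-4-≤2 {F = F} facet =
  +-cancelˡ-≤ 3 ∣ F ∣ 2 (subst (3 + ∣ F ∣ ≤_) (proj₁ facet) (three-of-first-four facet))

inDelta-avoiding-first-four-≤2 : ∀ {m} {T : Subset m} →
  InDelta 5 (4 + m) (outside ∷ outside ∷ outside ∷ outside ∷ T) → ∣ T ∣ ≤ 2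
inDelta-avoiding-first-four-≤2 (_ ∷ _ ∷ _ ∷ _ ∷ _ , facet , T⊆F) =
  ≤-trans (p⊆q⇒∣p∣≤∣q∣ (drop-∷-⊆ (drop-∷-⊆ (drop-∷-⊆ (drop-∷-⊆ T⊆F)))))
          (deltaFacet-beyond-4-≤2 facet)

∣p∣≡suc⇒nonempty : ∀ {n k} {p : Subset n} → ∣ p ∣ ≡ suc k → Nonempty p
∣p∣≡suc⇒nonempty {p = inside ∷ p} _ = zero , here
∣p∣≡suc⇒nonempty {p = outside ∷ p} ∣p∣≡1+k with ∣p∣≡suc⇒nonempty ∣p∣≡1+k
... | x , x∈p = suc x , there x∈p

x∈p⇒suc∣p-x∣≡∣p∣ : ∀ {n} {p : Subset n} {x} → x ∈ p → suc ∣ p [ x ]≔ outside ∣ ≡ ∣ p ∣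
x∈p⇒suc∣p-x∣≡∣p∣ here = refl
x∈p⇒suc∣p-x∣≡∣p∣ {p = outside ∷ p} (there x∈p) = x∈p⇒suc∣p-x∣≡∣p∣ x∈p
x∈p⇒suc∣p-x∣≡∣p∣ {p = inside ∷ p} (there x∈p) = cong suc (x∈p⇒suc∣p-x∣≡∣p∣ x∈p)

shifted-face-through-first : ∀ {n k} {K : Family (suc n)} → IsShifted K →
  ∀ S → S ∈K K → ∣ S ∣ ≡ suc k → Σ (Subset n) λ T → T ∈K link K × ∣ T ∣ ≡ k
shifted-face-through-first _ (inside ∷ S) S∈K ∣S∣≡1+k = S , S∈K , suc-injective ∣S∣≡1+k
shifted-face-through-first shifted (outside ∷ S) S∈K ∣S∣≡1+k
  with ∣p∣≡suc⇒nonempty {p = S} ∣S∣≡1+k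
... | x , x∈S = S [ x ]≔ outside , shifted (outside ∷ S) (suc x) zero S∈K (there x∈S) z<s
              , suc-injective (trans (x∈p⇒suc∣p-x∣≡∣p∣ x∈S) ∣S∣≡1+k)

mainTheorem6 : ∀ (n : ℕ) → 5 ≤ n → (K : Family n) →
    IsSimplicialComplex K → IsTwoDimensional K → IsShifted K → SubcomplexOfDelta 5 n K →
    (f 2 K + 8 ≤ 4 * f 1 K) × (f 2 K < 4 * f 1 K)
mainTheorem6 _ (s≤s (s≤s (s≤s (s≤s _)))) K closed ((S , S∈K , ∣S∣≡3) , _) shifted K⊆Δ =
  f₂+8≤4f₁ , <-≤-trans (m<m+n (f 2 K) z<s) f₂+8≤4f₁
  where
  a : ℕ
  a = f 1 (deletion K)

  link-has-two-vertices : 2 ≤ f 0 (link K)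
  link-has-two-vertices with shifted-face-through-first shifted S S∈K ∣S∣≡3
  ... | T , T∈link , ∣T∣≡2 =
    subst (_≤ f 0 (link K)) ∣T∣≡2 (∣face∣≤f₀ (IsSimplicialComplex-link closed) T T∈link)

  no-triangle-avoiding-first-four : f 2 (deletionⁿ 4 K) ≡ 0
  no-triangle-avoiding-first-four =
    f-above-dim≡0 2 (deletionⁿ 4 K) (λ T T∈K → inDelta-avoiding-first-four-≤2 (K⊆Δ _ T∈K))

  f₂+8≤4f₁ : f 2 K + 8 ≤ 4 * f 1 K
  f₂+8≤4f₁ = begin
    f 2 K + 8                          ≤⟨ +-monoˡ-≤ 8 (f-suc≤deletionⁿ 1 3 closed) ⟩
    f 2 (deletionⁿ 4 K) + 4 * a + 8    ≡⟨ cong (λ t → t + 4 * a + 8) no-triangle-avoiding-first-four ⟩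
    4 * a + 4 * 2                      ≡⟨ sym (*-distribˡ-+ 4 a 2) ⟩
    4 * (a + 2)                        ≤⟨ *-monoʳ-≤ 4 (+-monoʳ-≤ a link-has-two-vertices) ⟩
    4 * (a + f 0 (link K))             ≡⟨ cong (4 *_) (sym (f-deletion-link 0 K)) ⟩
    4 * f 1 K                          ∎
    where open ≤-Reasoning
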